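{- Let $G$ be a C0P-graph whose partition $(C_1,C_2,U)$ (with respect to a fixed vertex ordering as in the context) has $U=\emptyset$. Let $\{i,j\}=\{1,2\}$, let $S\subseteq C_j$, and let $t$ be a positive integer such that $|N_G[v]\cap S|\geq t$ for every $v\in C_i$. Then $|S|\geq t+1$.
   Context: For a graph $G$ with vertices $v_1,\dots,v_n$, the augmented adjacency matrix $M^*(G)=(m^*_{ij})$ has $m^*_{ij}=1$ if $i=j$ or $v_iv_j\in E(G)$, and $0$ otherwise. $G$ is a C0P-graph if its vertices can be ordered $v_1,\dots,v_n$ so that in every column of $M^*(G)$ the $0$ entries occur in consecutive rows. Fix such an ordering. Since diagonal entries are $1$, the zeros of column $j$ lie either all below the diagonal or all above. Let $C_1$ be the set of $v_j$ whose column has zeros, all below the diagonal; $C_2$ the set of $v_j$ whose column has zeros, all above the diagonal; $U$ the set of $v_j$ whose column has no zeros (the universal vertices). $N_G[v]=N_G(v)\cup\{v\}$. (In the paper's terminology, the hypothesis says that $S$ $t$-dominates $G_i=G[C_i]$.) -}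

module Defs where

open import Data.Nat using (ℕ; _≤_; _<_)
open import Data.Bool using (Bool; true; false; _∨_; if_then_else_)
open import Data.Fin using (Fin; toℕ; _≟_)
open import Data.Fin.Subset using (Subset)
open import Data.Vec using (tabulate)
open import Data.Product using (∃; _×_)
open import Relation.Binary.PropositionalEquality using (_≡_)
open import Relation.Nullary using (¬_; does)

-- A finite simple graph on vertex set Fin n; the vertex v_k is the element k,
-- so the fixed vertex ordering is the natural order on Fin n.
record Graph (n : ℕ) : Set where
  field
    adj     : Fin n → Fin n → Bool
    sym     : ∀ u v → adj u v ≡ adj v u
    irrefl  : ∀ v → adj v v ≡ false
open Graph public

M* : ∀ {n} → Graph n → Fin n → Fin n → Bool
M* G r c = does (r ≟ c) ∨ adj G r c

IsC0POrdering : ∀ {n} → Graph n → Set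
IsC0POrdering {n} G =
  ∀ (c a b d : Fin n) → toℕ a ≤ toℕ b → toℕ b ≤ toℕ d →
    M* G a c ≡ false → M* G d c ≡ false → M* G b c ≡ false

HasZero : ∀ {n} → Graph n → Fin n → Set
HasZero G v = ∃ λ r → M* G r v ≡ false

C₁ : ∀ {n} → Graph n → Fin n → Set
C₁ G v = HasZero G v × (∀ r → M* G r v ≡ false → toℕ v < toℕ r)

C₂ : ∀ {n} → Graph n → Fin n → Set
C₂ G v = HasZero G v × (∀ r → M* G r v ≡ false → toℕ r < toℕ v)

U : ∀ {n} → Graph n → Fin n → Set
U G v = ∀ r → M* G r v ≡ true

data Part : Set where
  one two : Part

other : Part → Part
other one = two
other two = one

C : ∀ {n} → Part → Graph n → Fin n → Set
C one = C₁
C two = C₂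

N[_]_ : ∀ {n} → Graph n → Fin n → Subset n
N[ G ] v = tabulate (λ u → does (u ≟ v) ∨ adj G v u)

-- Since U is empty, the first vertex lies in C₁ and the last in C₂, so C_i is
-- nonempty and t ≥ 1 forces S ≠ ∅. Take s ∈ S ⊆ C_j and a zero of column s, in
-- row r. By symmetry of M*, column r has a zero in row s, on the side of the
-- diagonal opposite to the one prescribed for C_j; as the zeros of a column are
-- consecutive and the diagonal is 1, all zeros of column r lie on that side, so
-- r ∈ C_i. Hence t ≤ |N[r] ∩ S|, and s ∈ S ∖ N[r] makes the inequality strict.
module Submission where

open import Defs
open import Data.Nat using (ℕ; suc; _≤_; _<_; s≤s)
open import Data.Nat.Properties using (≤-trans; <-cmp; ≤∧≢⇒<; n≢0⇒n>0; <⇒≤)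
open import Data.Fin using (Fin; toℕ; _≟_; fromℕ) renaming (zero to fzero)
open import Data.Fin.Properties using (toℕ-injective; ≤fromℕ; ¬∀⟶∃¬)
open import Data.Fin.Subset using (Subset; _∈_; _∉_; _∩_; ∣_∣; Nonempty)
open import Data.Fin.Subset.Properties
  using (nonempty?; Empty-unique; ∣⊥∣≡0; p⊂q⇒∣p∣<∣q∣; p∩q⊆q; x∈p∩q⁻; ∣p∩q∣≤∣q∣)
open import Data.Bool using (true; false; _∨_)
open import Data.Bool.Properties using (¬-not) renaming (_≟_ to _≟ᵇ_)
open import Data.Product using (∃; _,_; proj₁)
open import Data.Vec using (lookup)
open import Data.Vec.Properties using (lookup∘tabulate; []=⇒lookup)
open import Relation.Binary.Definitions using (tri<; tri≈; tri>)
open import Relation.Binary.PropositionalEquality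
  using (_≡_; _≢_; refl; cong; cong₂; trans; subst; module ≡-Reasoning)
  renaming (sym to ≡-sym)
open import Relation.Nullary using (¬_; yes; no; does; contradiction)
open import Relation.Nullary.Decidable using (dec-true)

0<∣p∣⇒Nonempty : ∀ {n} {p : Subset n} → 0 < ∣ p ∣ → Nonempty p
0<∣p∣⇒Nonempty {n} {p} 0<∣p∣ with nonempty? p
... | yes ne = ne
... | no ¬ne with refl ← Empty-unique ¬ne = contradiction (subst (0 <_) (∣⊥∣≡0 n) 0<∣p∣) λ ()

x∈q∧x∉p⇒∣p∩q∣<∣q∣ : ∀ {n} {p q : Subset n} {x} → x ∈ q → x ∉ p → ∣ p ∩ q ∣ < ∣ q ∣
x∈q∧x∉p⇒∣p∩q∣<∣q∣ {p = p} {q} x∈q x∉p =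
  p⊂q⇒∣p∣<∣q∣ (p∩q⊆q p q , _ , x∈q , λ x∈p∩q → x∉p (proj₁ (x∈p∩q⁻ p q x∈p∩q)))

module _ {n} (G : Graph n) where

  does-≟-sym : ∀ (u v : Fin n) → does (u ≟ v) ≡ does (v ≟ u)
  does-≟-sym u v with u ≟ v | v ≟ u
  ... | yes _   | yes _   = refl
  ... | no _    | no _    = refl
  ... | yes u≡v | no v≢u  = contradiction (≡-sym u≡v) v≢u
  ... | no u≢v  | yes v≡u = contradiction (≡-sym v≡u) u≢v

  M*-sym : ∀ u v → M* G u v ≡ M* G v u
  M*-sym u v = cong₂ _∨_ (does-≟-sym u v) (Graph.sym G u v)

  M*-diagonal : ∀ v → M* G v v ≢ false
  M*-diagonal v zvv with () ← trans (≡-sym (cong (_∨ adj G v v) (dec-true (v ≟ v) refl))) zvv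

  M*≡false⇒toℕ≢ : ∀ {u v} → M* G u v ≡ false → toℕ u ≢ toℕ v
  M*≡false⇒toℕ≢ {u} zuv u≡v with refl ← toℕ-injective u≡v = M*-diagonal u zuv

  lookup-N[] : ∀ u v → lookup (N[ G ] v) u ≡ M* G u v
  lookup-N[] u v = begin
    lookup (N[ G ] v) u          ≡⟨ lookup∘tabulate _ u ⟩
    does (u ≟ v) ∨ adj G v u     ≡⟨ cong (does (u ≟ v) ∨_) (Graph.sym G v u) ⟩
    M* G u v                     ∎
    where open ≡-Reasoning

  M*≡false⇒∉N[] : ∀ {u v} → M* G v u ≡ false → u ∉ N[ G ] v
  M*≡false⇒∉N[] {u} {v} zvu u∈N = contradiction true≡false λ ()
    where
    open ≡-Reasoning
    true≡false : true ≡ false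
    true≡false = begin
      true                   ≡⟨ ≡-sym ([]=⇒lookup u∈N) ⟩
      lookup (N[ G ] v) u    ≡⟨ lookup-N[] u v ⟩
      M* G u v               ≡⟨ M*-sym u v ⟩
      M* G v u               ≡⟨ zvu ⟩
      false                  ∎

  ¬U⇒HasZero : ∀ v → ¬ U G v → HasZero G v
  ¬U⇒HasZero v ¬U with ¬∀⟶∃¬ n (λ r → M* G r v ≡ true) (λ r → M* G r v ≟ᵇ true) ¬U
  ... | r , M*≢true = r , ¬-not M*≢true

  C⇒HasZero : ∀ i {v} → C i G v → HasZero G v
  C⇒HasZero one = proj₁
  C⇒HasZero two = proj₁

  module _ (c0p : IsC0POrdering G) where

    zero-below⇒C₁ : ∀ {s r} → M* G s r ≡ false → toℕ r < toℕ s → C₁ G r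
    zero-below⇒C₁ {s} {r} zs r<s = (s , zs) , below
      where
      below : ∀ x → M* G x r ≡ false → toℕ r < toℕ x
      below x zx with <-cmp (toℕ x) (toℕ r)
      ... | tri< x<r _ _ = contradiction (c0p r x r s (<⇒≤ x<r) (<⇒≤ r<s) zx zs) (M*-diagonal r)
      ... | tri≈ _ x≡r _ = contradiction x≡r (M*≡false⇒toℕ≢ zx)
      ... | tri> _ _ r<x = r<x

    zero-above⇒C₂ : ∀ {s r} → M* G s r ≡ false → toℕ s < toℕ r → C₂ G r
    zero-above⇒C₂ {s} {r} zs s<r = (s , zs) , above
      where
      above : ∀ x → M* G x r ≡ false → toℕ x < toℕ r
      above x zx with <-cmp (toℕ x) (toℕ r)
      ... | tri< x<r _ _ = x<r
      ... | tri≈ _ x≡r _ = contradiction x≡r (M*≡false⇒toℕ≢ zx)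
      ... | tri> _ _ r<x = contradiction (c0p r s r x (<⇒≤ s<r) (<⇒≤ r<x) zs zx) (M*-diagonal r)

    zero-of-C-other⇒C : ∀ i {s r} → C (other i) G s → M* G r s ≡ false → C i G r
    zero-of-C-other⇒C one {s} {r} (_ , above) zrs =
      zero-below⇒C₁ (trans (M*-sym s r) zrs) (above r zrs)
    zero-of-C-other⇒C two {s} {r} (_ , below) zrs =
      zero-above⇒C₂ (trans (M*-sym s r) zrs) (below r zrs)

  C-nonempty : 1 ≤ n → (∀ v → ¬ U G v) → ∀ i → ∃ (C i G)
  C-nonempty (s≤s _) ¬U one = fzero , ¬U⇒HasZero fzero (¬U fzero) , λ r zr →
    n≢0⇒n>0 (M*≡false⇒toℕ≢ zr)
  C-nonempty (s≤s {n = m} _) ¬U two = fromℕ m , ¬U⇒HasZero (fromℕ m) (¬U (fromℕ m)) , λ r zr →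
    ≤∧≢⇒< (≤fromℕ r) (M*≡false⇒toℕ≢ zr)

lemma4 : ∀ {n} (G : Graph n) → 1 ≤ n → IsC0POrdering G →
    (∀ v → ¬ U G v) →
    (i : Part) (S : Subset n) → (∀ v → v ∈ S → C (other i) G v) →
    (t : ℕ) → 1 ≤ t →
    (∀ v → C i G v → t ≤ ∣ (N[ G ] v) ∩ S ∣) →
    suc t ≤ ∣ S ∣
lemma4 G 1≤n c0p ¬U i S S⊆C-other t 1≤t dominated =
  let w , w∈C = C-nonempty G 1≤n ¬U i
      s , s∈S = 0<∣p∣⇒Nonempty (≤-trans 1≤t (≤-trans (dominated w w∈C) (∣p∩q∣≤∣q∣ (N[ G ] w) S)))
      s∈C-other = S⊆C-other s s∈S
      r , zrs = C⇒HasZero G (other i) s∈C-other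
      r∈C = zero-of-C-other⇒C G c0p i s∈C-other zrs
  in ≤-trans (s≤s (dominated r r∈C)) (x∈q∧x∉p⇒∣p∩q∣<∣q∣ s∈S (M*≡false⇒∉N[] G zrs))
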